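{- Let $\mathcal{H}$ be a finite family of digraphs and let $P\in\mathcal{H}$ be a directed path of length $p$. Let $D$ be a digraph containing no subgraph isomorphic to a graph in $\mathcal{H}^-_p$, and let $k$ be an integer. Then $(D,k)$ is a yes-instance of $\mathcal{H}$-SCC if and only if it is a yes-instance of $\{P\}$-SCC.
   Context: For a family $\mathcal{F}$ of digraphs, $(D,k)$ is a yes-instance of $\mathcal{F}$-SCC if there is $X\subseteq V(D)$ with $|X|\le k$ such that no strongly connected component of $D-X$ contains a subgraph isomorphic to a graph in $\mathcal{F}$. For a digraph $H$, $GPC(H)$ consists of all strongly connected digraphs of the form $H\cup P_1\cup\dots\cup P_\ell$, where each $P_i$ is a directed path with both end-points in $V(H)$ (paths not necessarily disjoint), no two of the paths having the same ordered pair of end-points; $\{P_1,\dots,P_\ell\}$ is a witnessing collection of paths. $GPC(\mathcal{H})=\bigcup_{H\in\mathcal{H}}GPC(H)$. $\mathcal{H}^-_p$ is the set of digraphs in $GPC(\mathcal{H})$ that have some witnessing collection of paths in which every path has length at most $p-1$. Length of a path is its number of arcs. -}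

module Defs where

open import Data.Nat using (ℕ; zero; suc; _<_; _≤_)
open import Data.Integer as ℤ using (ℤ; +_)
open import Data.Fin using (Fin; toℕ)
open import Data.Fin.Subset using (Subset; _∈_; _∉_; ∣_∣)
open import Data.Bool using (Bool; true; false)
open import Data.List using (List; []; _∷_; length)
open import Data.List.Relation.Unary.Unique.Propositional using (Unique)
open import Data.List.Relation.Unary.AllPairs using (AllPairs)
open import Data.List.Relation.Unary.Any using (Any)
import Data.List.Membership.Propositional as LM
open import Data.Product using (Σ; ∃; ∃-syntax; _×_; _,_)
open import Data.Sum using (_⊎_)
open import Relation.Binary.PropositionalEquality using (_≡_; _≢_)
open import Relation.Nullary using (¬_)
open import Function.Definitions using (Injective)

record Digraph : Set where
  field
    n        : ℕ
    arc      : Fin n → Fin n → Bool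
    loopless : ∀ v → arc v v ≡ false

open Digraph public

V : Digraph → Set
V G = Fin (n G)

Arc : (G : Digraph) → V G → V G → Set
Arc G u v = arc G u v ≡ true

record Iso (G H : Digraph) : Set where
  field
    to      : V G → V H
    from    : V H → V G
    from-to : ∀ x → from (to x) ≡ x
    to-from : ∀ y → to (from y) ≡ y
    arc-iff : ∀ u v → arc G u v ≡ arc H (to u) (to v)

-- An injective arc-preserving map F → D: D has a subgraph isomorphic to F.
record Embedding (F D : Digraph) : Set where
  field
    map      : V F → V D
    injective : Injective _≡_ _≡_ map
    arc-pres : ∀ u v → Arc F u v → Arc D (map u) (map v)

PathDigraph : ℕ → Digraph
PathDigraph p = record
  { n = suc p
  ; arc = λ i j → toℕ j ≡ᵇ suc (toℕ i)
  ; loopless = λ v → lemma (toℕ v)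
  }
  where
  open import Data.Nat using (_≡ᵇ_)
  lemma : ∀ m → (m ≡ᵇ suc m) ≡ false
  lemma zero = Relation.Binary.PropositionalEquality.refl
    where import Relation.Binary.PropositionalEquality
  lemma (suc m) = lemma m

IsDirectedPath : ℕ → Digraph → Set
IsDirectedPath p P = Iso (PathDigraph p) P

data Reach (G : Digraph) (allowed : V G → Set) : V G → V G → Set where
  here : ∀ {u} → allowed u → Reach G allowed u u
  step : ∀ {u w v} → allowed u → Arc G u w → Reach G allowed w v →
         Reach G allowed u v

StronglyConnected : Digraph → Set
StronglyConnected G = ∀ u v → Reach G (λ _ → ⊤) u v
  where open import Data.Unit using (⊤)

SameSCC : (D : Digraph) → Subset (n D) → V D → V D → Set
SameSCC D X u v = Reach D (λ w → w ∉ X) u v × Reach D (λ w → w ∉ X) v u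

-- Some strong component of D - X contains a subgraph isomorphic to F:
-- there is a vertex c of D - X (naming the component) and an embedding
-- of F into D whose image lies in the strong component of c.
SCCContains : (D : Digraph) → Subset (n D) → Digraph → Set
SCCContains D X F =
  Σ (V D) λ c → c ∉ X × Σ (Embedding F D) λ e →
    ∀ x → SameSCC D X c (Embedding.map e x)

YesInstance : (Digraph → Set) → Digraph → ℤ → Set
YesInstance 𝓕 D k =
  Σ (Subset (n D)) λ X → (+ ∣ X ∣) ℤ.≤ k ×
    (∀ F → 𝓕 F → ¬ SCCContains D X F)

-- Directed paths inside a digraph G, given as a start vertex followed
-- by the list of the remaining vertices. Length = length of the rest.

data Chain (G : Digraph) : V G → List (V G) → Set where
  []  : ∀ {s} → Chain G s []
  _∷_ : ∀ {s x xs} → Arc G s x → Chain G x xs → Chain G s (x ∷ xs)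

lastV : ∀ {A : Set} → A → List A → A
lastV s []       = s
lastV s (x ∷ xs) = lastV x xs

data ConsecIn {A : Set} (x y : A) : A → List A → Set where
  here  : ∀ {l} → ConsecIn x y x (y ∷ l)
  there : ∀ {s z l} → ConsecIn x y z l → ConsecIn x y s (z ∷ l)

record PathIn (G : Digraph) : Set where
  field
    start    : V G
    rest     : List (V G)
    distinct : Unique (start ∷ rest)
    chain    : Chain G start rest

  pathLength : ℕ
  pathLength = length rest

  finish : V G
  finish = lastV start rest

  endpoints : V G × V G
  endpoints = start , finish

open PathIn public

-- G ∈ GPC(H) with a witnessing collection of paths all of length ≤ p - 1
-- (i.e. length < p).  H is identified with a subgraph of G via `emb`.

record GPCWitness (p : ℕ) (H G : Digraph) : Set where
  field
    emb        : Embedding H G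
    paths      : List (PathIn G)
    ends-in-H  : ∀ P → P LM.∈ paths →
                   (∃[ a ] Embedding.map emb a ≡ start P) ×
                   (∃[ b ] Embedding.map emb b ≡ finish P)
    distinct-ends : AllPairs (λ P Q → endpoints P ≢ endpoints Q) paths
    short      : ∀ P → P LM.∈ paths → pathLength P < p
    -- G = H ∪ P₁ ∪ … ∪ Pℓ
    vertices-covered : ∀ x → (∃[ a ] Embedding.map emb a ≡ x) ⊎
                             Any (λ P → x LM.∈ (start P ∷ rest P)) paths
    arcs-covered : ∀ x y → Arc G x y →
                   (∃[ a ] ∃[ b ] (Embedding.map emb a ≡ x ×
                                   Embedding.map emb b ≡ y × Arc H a b)) ⊎
                   Any (λ P → ConsecIn x y (start P) (rest P)) paths
    strong     : StronglyConnected G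

InHMinus : List Digraph → ℕ → Digraph → Set
InHMinus 𝓗 p G = Σ Digraph λ H → H LM.∈ 𝓗 × GPCWitness p H G

FreeOfHMinus : List Digraph → ℕ → Digraph → Set
FreeOfHMinus 𝓗 p D = ∀ G → InHMinus 𝓗 p G → ¬ Embedding G D

InList : List Digraph → Digraph → Set
InList 𝓗 F = F LM.∈ 𝓗

Singleton : Digraph → Digraph → Set
Singleton P F = F ≡ P

-- Suppose no strong component of D - X contains P, but one of them contains a
-- copy of some H ∈ 𝓗. Two vertices of the copy are joined inside that
-- component by a path without repeated vertices, and every vertex of such a
-- path stays in the component; so the path has fewer than p arcs, as otherwise
-- its first p arcs would be a copy of P there. The copy of H together with one
-- such path for every ordered pair of its vertices is a strongly connected
-- subgraph of D that lies in GPC(H) with all witnessing paths shorter than p,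
-- i.e. a member of 𝓗⁻_p, which D excludes. The converse holds as P ∈ 𝓗.
module Submission where

open import Defs
open import Data.Nat using (ℕ)
open import Data.Integer using (ℤ)
open import Data.List using (List)
open import Data.List.Membership.Propositional using (_∈_)
open import Function.Bundles using (_⇔_)

open import Data.Nat using (zero; suc; _≤_; _<_; s≤s; _≤?_)
open import Data.Nat.Properties using (≰⇒>)
open import Data.Fin as Fin using (Fin; zero; suc)
import Data.Fin.Properties as FinP
open import Data.Fin.Subset using (Subset; _∉_)
open import Data.Bool as Bool using (true; false)
open import Data.List using ([]; _∷_; length; lookup; map; allFin; filter; cartesianProduct)
open import Data.List.Properties using (length-map)
open import Data.List.Relation.Unary.All as All using (All; []; _∷_)
open import Data.List.Relation.Unary.All.Properties.Core using (¬Any⇒All¬)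
open import Data.List.Relation.Unary.Any as Any using (Any; here; there)
import Data.List.Relation.Unary.Any.Properties as AnyP
open import Data.List.Relation.Unary.AllPairs as AllPairs using ([]; _∷_)
import Data.List.Relation.Unary.AllPairs.Properties as AllPairsP
open import Data.List.Relation.Unary.Unique.Propositional using (Unique)
import Data.List.Relation.Unary.Unique.Propositional.Properties as UniqueP
open import Data.List.Membership.Propositional using (lose)
open import Data.List.Membership.Propositional.Properties
  using (∈-map⁺; ∈-map⁻; ∈-lookup; ∈-allFin; ∈-filter⁺; ∈-filter⁻; ∈-cartesianProduct⁺)
open import Data.List.Membership.DecPropositional as DecMembership using ()
open import Data.Product using (Σ; ∃-syntax; _×_; _,_; proj₁; proj₂)
open import Data.Sum using (_⊎_; inj₁; inj₂)
open import Data.Empty using (⊥-elim)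
open import Data.Unit using (⊤; tt)
open import Relation.Binary.Definitions using (DecidableEquality)
open import Relation.Binary.PropositionalEquality
open import Relation.Nullary using (¬_; Dec; yes; no; does)
open import Relation.Nullary.Decidable using (_×-dec_; _⊎-dec_; dec-true; dec-false)
open import Function using (_∘_; id)

dec-true⁻¹ : ∀ {P : Set} (P? : Dec P) → does P? ≡ true → P
dec-true⁻¹ (yes p) _ = p
dec-true⁻¹ (no _) ()

lookup-injective : ∀ {A : Set} {xs : List A} → Unique xs →
                   ∀ i j → lookup xs i ≡ lookup xs j → i ≡ j
lookup-injective (x∉ ∷ u) zero    zero    eq = refl
lookup-injective (x∉ ∷ u) zero    (suc j) eq = ⊥-elim (All.lookup x∉ (∈-lookup j) eq)
lookup-injective (x∉ ∷ u) (suc i) zero    eq = ⊥-elim (All.lookup x∉ (∈-lookup i) (sym eq))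
lookup-injective (x∉ ∷ u) (suc i) (suc j) eq = cong suc (lookup-injective u i j eq)

module _ {A : Set} where

  ConsecIn⇒∈ : ∀ {x y s : A} {l} → ConsecIn x y s l → x ∈ s ∷ l × y ∈ s ∷ l
  ConsecIn⇒∈ here      = here refl , there (here refl)
  ConsecIn⇒∈ (there c) = let x∈ , y∈ = ConsecIn⇒∈ c in there x∈ , there y∈

  ConsecIn-map : ∀ {B : Set} (g : A → B) {x y s l} →
                 ConsecIn x y s l → ConsecIn (g x) (g y) (g s) (map g l)
  ConsecIn-map g here      = here
  ConsecIn-map g (there c) = there (ConsecIn-map g c)

  lastV-map : ∀ {B : Set} (g : A → B) s l → lastV (g s) (map g l) ≡ g (lastV s l)
  lastV-map g s []      = refl
  lastV-map g s (x ∷ l) = lastV-map g x l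

  consecIn? : DecidableEquality A → ∀ x y s l → Dec (ConsecIn x y s l)
  consecIn? _≟_ x y s [] = no λ ()
  consecIn? _≟_ x y s (z ∷ l) with consecIn? _≟_ x y z l | x ≟ s | y ≟ z
  ... | yes c | _        | _        = yes (there c)
  ... | no ¬c | yes refl | yes refl = yes here
  ... | no ¬c | no x≢s   | _        = no λ { here → x≢s refl ; (there c) → ¬c c }
  ... | no ¬c | yes _    | no y≢z   = no λ { here → y≢z refl ; (there c) → ¬c c }

Chain-arc : ∀ {G : Digraph} {x y s l} → Chain G s l → ConsecIn x y s l → Arc G x y
Chain-arc (a ∷ c) here      = a
Chain-arc (a ∷ c) (there k) = Chain-arc c k

embed-iso : ∀ {F F′ D} → Iso F F′ → Embedding F D → Embedding F′ D
embed-iso {F′ = F′} iso e = record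
  { map       = Embedding.map e ∘ from
  ; injective = λ {u} {v} eq →
      trans (sym (to-from u)) (trans (cong to (Embedding.injective e eq)) (to-from v))
  ; arc-pres  = λ u v a → Embedding.arc-pres e (from u) (from v)
      (trans (arc-iff (from u) (from v)) (trans (cong₂ (arc F′) (to-from u) (to-from v)) a))
  }
  where open Iso iso

record SimplePath (G : Digraph) (A : V G → Set) (u v : V G) : Set where
  field
    tail    : List (V G)
    unique  : Unique (u ∷ tail)
    chain   : Chain G u tail
    ends-at : lastV u tail ≡ v
    allowed : All A (u ∷ tail)

module SP = SimplePath

module _ {G : Digraph} {A : V G → Set} where

  Reach-trans : ∀ {u w v} → Reach G A u w → Reach G A w v → Reach G A u v
  Reach-trans (here a)     r′ = r′
  Reach-trans (step a e r) r′ = step a e (Reach-trans r r′)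

  Chain⇒Reach-from-start : ∀ {s l w} → Chain G s l → All A (s ∷ l) → w ∈ s ∷ l → Reach G A s w
  Chain⇒Reach-from-start c       (a ∷ _)  (here refl) = here a
  Chain⇒Reach-from-start (e ∷ c) (a ∷ as) (there w∈)  = step a e (Chain⇒Reach-from-start c as w∈)

  Chain⇒Reach-to-end : ∀ {s l w} → Chain G s l → All A (s ∷ l) → w ∈ s ∷ l → Reach G A w (lastV s l)
  Chain⇒Reach-to-end []      (a ∷ [])  (here refl) = here a
  Chain⇒Reach-to-end (e ∷ c) (a ∷ as) (here refl) = step a e (Chain⇒Reach-to-end c as (here refl))
  Chain⇒Reach-to-end (e ∷ c) (a ∷ as) (there w∈)  = Chain⇒Reach-to-end c as w∈

  suffix-from : ∀ {u s l} → u ∈ s ∷ l → Unique (s ∷ l) → Chain G s l → All A (s ∷ l) →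
                SimplePath G A u (lastV s l)
  suffix-from {l = l} (here refl) u c as = record
    { tail = l ; unique = u ; chain = c ; ends-at = refl ; allowed = as }
  suffix-from (there u∈) (_ ∷ u) (_ ∷ c) (_ ∷ as) = suffix-from u∈ u c as

  -- Loop erasure: if u recurs on the erased rest of the walk, start from that occurrence.
  Reach⇒SimplePath : ∀ {u v} → Reach G A u v → SimplePath G A u v
  Reach⇒SimplePath (here a) = record
    { tail = [] ; unique = [] ∷ [] ; chain = [] ; ends-at = refl ; allowed = a ∷ [] }
  Reach⇒SimplePath {u} (step {w = w} a e r)
    with Reach⇒SimplePath r
  ... | π with DecMembership._∈?_ Fin._≟_ u (w ∷ SP.tail π)
  ...   | yes u∈ = subst (SimplePath G A u) (SP.ends-at π)
                     (suffix-from u∈ (SP.unique π) (SP.chain π) (SP.allowed π))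
  ...   | no u∉ = record
    { tail    = w ∷ SP.tail π
    ; unique  = ¬Any⇒All¬ _ u∉ ∷ SP.unique π
    ; chain   = e ∷ SP.chain π
    ; ends-at = SP.ends-at π
    ; allowed = a ∷ SP.allowed π
    }

module _ {G : Digraph} where

  vertexAt : (q : ℕ) → V G → List (V G) → Fin (suc q) → V G
  vertexAt _       s l       zero    = s
  vertexAt (suc q) s []      (suc i) = s
  vertexAt (suc q) s (x ∷ l) (suc i) = vertexAt q x l i

  vertexAt-∈ : ∀ q s l → q ≤ length l → ∀ i → vertexAt q s l i ∈ s ∷ l
  vertexAt-∈ q       s l       _         zero    = here refl
  vertexAt-∈ (suc q) s (x ∷ l) (s≤s q≤) (suc i) = there (vertexAt-∈ q x l q≤ i)

  vertexAt-injective : ∀ q s l → q ≤ length l → Unique (s ∷ l) →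
                       ∀ i j → vertexAt q s l i ≡ vertexAt q s l j → i ≡ j
  vertexAt-injective q s l _ _ zero zero _ = refl
  vertexAt-injective (suc q) s (x ∷ l) (s≤s q≤) (s∉ ∷ _) zero (suc j) eq =
    ⊥-elim (All.lookup s∉ (vertexAt-∈ q x l q≤ j) eq)
  vertexAt-injective (suc q) s (x ∷ l) (s≤s q≤) (s∉ ∷ _) (suc i) zero eq =
    ⊥-elim (All.lookup s∉ (vertexAt-∈ q x l q≤ i) (sym eq))
  vertexAt-injective (suc q) s (x ∷ l) (s≤s q≤) (_ ∷ u) (suc i) (suc j) eq =
    cong suc (vertexAt-injective q x l q≤ u i j eq)

  vertexAt-arc : ∀ q s l → q ≤ length l → Chain G s l → ∀ i j →
                 Arc (PathDigraph q) i j → Arc G (vertexAt q s l i) (vertexAt q s l j)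
  vertexAt-arc (suc q) s (x ∷ l) _        (e ∷ c) zero    (suc zero)    _ = e
  vertexAt-arc (suc q) s (x ∷ l) (s≤s q≤) (e ∷ c) (suc i) (suc j)       a =
    vertexAt-arc q x l q≤ c i j a
  vertexAt-arc (suc q) s (x ∷ l) _        (e ∷ c) zero    (suc (suc j)) ()
  vertexAt-arc (suc q) s (x ∷ l) _        (e ∷ c) (suc i) zero          ()
  vertexAt-arc q       s l       _        _       zero    zero          ()

  path-embedding : ∀ q s l → q ≤ length l → Unique (s ∷ l) → Chain G s l →
                   Embedding (PathDigraph q) G
  path-embedding q s l q≤ u c = record
    { map       = vertexAt q s l
    ; injective = λ {i} {j} → vertexAt-injective q s l q≤ u i j
    ; arc-pres  = vertexAt-arc q s l q≤ c
    }

module Subdigraph (D : Digraph) (Vs : List (V D)) (Vs-unique : Unique Vs)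
  {R : V D → V D → Set} (R? : ∀ x y → Dec (R x y)) {x₀ : V D} (x₀∈Vs : x₀ ∈ Vs) where

  KeptArc? : ∀ x y → Dec (Arc D x y × R x y)
  KeptArc? x y = (arc D x y Bool.≟ true) ×-dec R? x y

  Sub : Digraph
  Sub = record
    { n        = length Vs
    ; arc      = λ i j → does (KeptArc? (lookup Vs i) (lookup Vs j))
    ; loopless = λ i → dec-false (KeptArc? _ _) λ (a , _) →
        case-true≢false (trans (sym a) (loopless D (lookup Vs i)))
    }
    where
    case-true≢false : true ≢ false
    case-true≢false ()

  Sub↪D : Embedding Sub D
  Sub↪D = record
    { map       = lookup Vs
    ; injective = λ {i} {j} → lookup-injective Vs-unique i j
    ; arc-pres  = λ i j a → proj₁ (dec-true⁻¹ (KeptArc? _ _) a)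
    }

  -- Outside Vs the index is junk (that of x₀); it is only used on Vs.
  index : V D → V Sub
  index x with DecMembership._∈?_ Fin._≟_ x Vs
  ... | yes x∈ = Any.index x∈
  ... | no _   = Any.index x₀∈Vs

  lookup-index : ∀ {x} → x ∈ Vs → lookup Vs (index x) ≡ x
  lookup-index {x} x∈ with DecMembership._∈?_ Fin._≟_ x Vs
  ... | yes x∈′ = sym (AnyP.lookup-index x∈′)
  ... | no x∉   = ⊥-elim (x∉ x∈)

  index-lookup : ∀ i → index (lookup Vs i) ≡ i
  index-lookup i = lookup-injective Vs-unique _ _ (lookup-index (∈-lookup i))

  index-injective : ∀ {x y} → x ∈ Vs → y ∈ Vs → index x ≡ index y → x ≡ y
  index-injective x∈ y∈ eq =
    trans (sym (lookup-index x∈)) (trans (cong (lookup Vs) eq) (lookup-index y∈))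

  Sub-arc⁺ : ∀ {x y} → x ∈ Vs → y ∈ Vs → Arc D x y → R x y → Arc Sub (index x) (index y)
  Sub-arc⁺ {x} {y} x∈ y∈ a r =
    subst₂ (λ u v → does (KeptArc? u v) ≡ true) (sym (lookup-index x∈)) (sym (lookup-index y∈))
      (dec-true (KeptArc? x y) (a , r))

  Sub-arc⁻ : ∀ {i j} → Arc Sub i j → R (lookup Vs i) (lookup Vs j)
  Sub-arc⁻ a = proj₂ (dec-true⁻¹ (KeptArc? _ _) a)

  index-unique : ∀ {xs} → Unique xs → All (_∈ Vs) xs → Unique (map index xs)
  index-unique []        []         = []
  index-unique (x∉ ∷ u) (x∈ ∷ xs∈) = index-≢ x∉ xs∈ ∷ index-unique u xs∈
    where
    index-≢ : ∀ {ys} → All (_ ≢_) ys → All (_∈ Vs) ys → All (index _ ≢_) (map index ys)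
    index-≢ []         []         = []
    index-≢ (x≢ ∷ x≢s) (y∈ ∷ ys∈) = (x≢ ∘ index-injective x∈ y∈) ∷ index-≢ x≢s ys∈

  index-chain : ∀ {s} l → (∀ {x y} → ConsecIn x y s l → Arc Sub (index x) (index y)) →
                Chain Sub (index s) (map index l)
  index-chain []      arcs = []
  index-chain (x ∷ l) arcs = arcs here ∷ index-chain l (arcs ∘ there)

  restrict : ∀ {s l} → Unique (s ∷ l) → Chain D s l → All (_∈ Vs) (s ∷ l) →
             (∀ {x y} → ConsecIn x y s l → R x y) → PathIn Sub
  restrict {s} {l} u c inVs kept = record
    { start    = index s
    ; rest     = map index l
    ; distinct = index-unique u inVs
    ; chain    = index-chain l λ k → let x∈ , y∈ = ConsecIn⇒∈ k in
        Sub-arc⁺ (All.lookup inVs x∈) (All.lookup inVs y∈) (Chain-arc c k) (kept k)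
    }

module ConnectedCopy {p : ℕ} {H D : Digraph} {A : V D → Set} (e : Embedding H D)
  (connector : ∀ a b → SimplePath D A (Embedding.map e a) (Embedding.map e b))
  (connector-short : ∀ a b → length (SP.tail (connector a b)) < p)
  (a₀ : V H) where

  f : V H → V D
  f = Embedding.map e

  pairs : List (V H × V H)
  pairs = cartesianProduct (allFin (n H)) (allFin (n H))

  ∈-pairs : ∀ ab → ab ∈ pairs
  ∈-pairs (a , b) = ∈-cartesianProduct⁺ (∈-allFin a) (∈-allFin b)

  tailOf : V H × V H → List (V D)
  tailOf (a , b) = SP.tail (connector a b)

  route : V H × V H → List (V D)
  route (a , b) = f a ∷ tailOf (a , b)

  OnRoute : V D → Set
  OnRoute x = Any (λ ab → x ∈ route ab) pairs

  Vs : List (V D)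
  Vs = filter (λ x → Any.any? (λ ab → DecMembership._∈?_ Fin._≟_ x (route ab)) pairs)
              (allFin (n D))

  route⊆Vs : ∀ ab {x} → x ∈ route ab → x ∈ Vs
  route⊆Vs ab x∈ = ∈-filter⁺ _ (∈-allFin _) (lose (∈-pairs ab) x∈)

  Vs⊆OnRoute : ∀ {x} → x ∈ Vs → OnRoute x
  Vs⊆OnRoute x∈ = proj₂ (∈-filter⁻ _ {xs = allFin (n D)} x∈)

  f∈Vs : ∀ a → f a ∈ Vs
  f∈Vs a = route⊆Vs (a , a) (here refl)

  HArc RouteArc Kept : V D → V D → Set
  HArc x y     = ∃[ a ] ∃[ b ] (f a ≡ x × f b ≡ y × Arc H a b)
  RouteArc x y = Any (λ ab → ConsecIn x y (f (proj₁ ab)) (tailOf ab)) pairs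
  Kept x y     = HArc x y ⊎ RouteArc x y

  kept? : ∀ x y → Dec (Kept x y)
  kept? x y =
    (FinP.any? λ a → FinP.any? λ b → (f a Fin.≟ x) ×-dec (f b Fin.≟ y) ×-dec (arc H a b Bool.≟ true))
    ⊎-dec Any.any? (λ ab → consecIn? Fin._≟_ x y (f (proj₁ ab)) (tailOf ab)) pairs

  open Subdigraph D Vs (UniqueP.filter⁺ _ (UniqueP.allFin⁺ (n D))) kept? (f∈Vs a₀) public

  connectorIn : V H × V H → PathIn Sub
  connectorIn (a , b) =
    restrict (SP.unique π) (SP.chain π) (All.tabulate (route⊆Vs (a , b)))
      (λ k → inj₂ (lose (∈-pairs (a , b)) k))
    where π = connector a b

  connectorIn-finish : ∀ a b → finish (connectorIn (a , b)) ≡ index (f b)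
  connectorIn-finish a b =
    trans (lastV-map index (f a) (tailOf (a , b))) (cong index (SP.ends-at (connector a b)))

  routeIn : V H × V H → List (V Sub)
  routeIn ab = start (connectorIn ab) ∷ rest (connectorIn ab)

  on-some-connector : ∀ i → Any (λ ab → i ∈ routeIn ab) pairs
  on-some-connector i = Any.map (λ x∈ → subst (_∈ routeIn _) (index-lookup i) (∈-map⁺ index x∈))
                                (Vs⊆OnRoute (∈-lookup i))

  Reach-from-connector : ∀ a b {i} → i ∈ routeIn (a , b) → Reach Sub (λ _ → ⊤) i (index (f b))
  Reach-from-connector a b i∈ = subst (Reach Sub _ _) (connectorIn-finish a b)
    (Chain⇒Reach-to-end (chain (connectorIn (a , b))) (All.tabulate (λ _ → tt)) i∈)

  Reach-to-connector : ∀ a b {i} → i ∈ routeIn (a , b) → Reach Sub (λ _ → ⊤) (index (f a)) i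
  Reach-to-connector a b i∈ =
    Chain⇒Reach-from-start (chain (connectorIn (a , b))) (All.tabulate (λ _ → tt)) i∈

  -- From a connector through i to f b₁, then the connector f b₁ ⇝ f a₂ to one through j.
  Sub-strong : StronglyConnected Sub
  Sub-strong i j with Any.satisfied (on-some-connector i) | Any.satisfied (on-some-connector j)
  ... | (a₁ , b₁) , i∈ | (a₂ , b₂) , j∈ =
    Reach-trans (Reach-from-connector a₁ b₁ i∈)
      (Reach-trans (Reach-from-connector b₁ a₂ (here refl)) (Reach-to-connector a₂ b₂ j∈))

  H↪Sub : Embedding H Sub
  H↪Sub = record
    { map       = index ∘ f
    ; injective = Embedding.injective e ∘ index-injective (f∈Vs _) (f∈Vs _)
    ; arc-pres  = λ a b ab → Sub-arc⁺ (f∈Vs a) (f∈Vs b) (Embedding.arc-pres e a b ab)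
                                     (inj₁ (a , b , refl , refl , ab))
    }

  connectors : List (PathIn Sub)
  connectors = map connectorIn pairs

  connectors-ends : ∀ Q → Q ∈ connectors →
    (∃[ a ] index (f a) ≡ start Q) × (∃[ b ] index (f b) ≡ finish Q)
  connectors-ends Q Q∈ with ∈-map⁻ connectorIn Q∈
  ... | (a , b) , _ , refl = (a , refl) , (b , sym (connectorIn-finish a b))

  connectors-distinct : AllPairs.AllPairs (λ Q Q′ → endpoints Q ≢ endpoints Q′) connectors
  connectors-distinct = AllPairsP.map⁺ (AllPairs.map endpoints-≢
    (UniqueP.cartesianProduct⁺ (UniqueP.allFin⁺ (n H)) (UniqueP.allFin⁺ (n H))))
    where
    f-index-injective : ∀ {a a′} → index (f a) ≡ index (f a′) → a ≡ a′
    f-index-injective = Embedding.injective e ∘ index-injective (f∈Vs _) (f∈Vs _)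

    endpoints-≢ : ∀ {ab ab′} → ab ≢ ab′ → endpoints (connectorIn ab) ≢ endpoints (connectorIn ab′)
    endpoints-≢ {a , b} {a′ , b′} ab≢ eq = ab≢ (cong₂ _,_
      (f-index-injective (cong proj₁ eq))
      (f-index-injective (trans (sym (connectorIn-finish a b))
                                (trans (cong proj₂ eq) (connectorIn-finish a′ b′)))))

  connectors-short : ∀ Q → Q ∈ connectors → pathLength Q < p
  connectors-short Q Q∈ with ∈-map⁻ connectorIn Q∈
  ... | (a , b) , _ , refl = subst (_< p) (sym (length-map index (tailOf (a , b))))
                                   (connector-short a b)

  connectors-cover-arcs : ∀ i j → Arc Sub i j →
    (∃[ a ] ∃[ b ] (index (f a) ≡ i × index (f b) ≡ j × Arc H a b)) ⊎
    Any (λ Q → ConsecIn i j (start Q) (rest Q)) connectors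
  connectors-cover-arcs i j a with Sub-arc⁻ {i} {j} a
  ... | inj₁ (a′ , b′ , fa′ , fb′ , ab) =
    inj₁ (a′ , b′ , trans (cong index fa′) (index-lookup i) , trans (cong index fb′) (index-lookup j) , ab)
  ... | inj₂ onRoute = inj₂ (AnyP.map⁺ (Any.map (λ k →
    subst₂ (λ u v → ConsecIn u v _ _) (index-lookup i) (index-lookup j) (ConsecIn-map index k)) onRoute))

  witness : GPCWitness p H Sub
  witness = record
    { emb              = H↪Sub
    ; paths            = connectors
    ; ends-in-H        = connectors-ends
    ; distinct-ends    = connectors-distinct
    ; short            = connectors-short
    ; vertices-covered = λ i → inj₂ (AnyP.map⁺ (on-some-connector i))
    ; arcs-covered     = connectors-cover-arcs
    ; strong           = Sub-strong
    }

Fin-inhabited? : ∀ m → Dec (Fin m)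
Fin-inhabited? zero    = no FinP.¬Fin0
Fin-inhabited? (suc m) = yes zero

-- ConnectedCopy needs a vertex of H; without one, H itself is the witness.
empty-GPCWitness : ∀ p H → ¬ V H → GPCWitness p H H
empty-GPCWitness p H ¬v = record
  { emb              = record { map = id ; injective = id ; arc-pres = λ _ _ a → a }
  ; paths            = []
  ; ends-in-H        = λ _ ()
  ; distinct-ends    = []
  ; short            = λ _ ()
  ; vertices-covered = λ x → ⊥-elim (¬v x)
  ; arcs-covered     = λ x → ⊥-elim (¬v x)
  ; strong           = λ u → ⊥-elim (¬v u)
  }

connected-copy⇒GPC : ∀ {p H D A} (e : Embedding H D) →
  (connector : ∀ a b → SimplePath D A (Embedding.map e a) (Embedding.map e b)) →
  (∀ a b → length (SP.tail (connector a b)) < p) →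
  Σ Digraph λ G → GPCWitness p H G × Embedding G D
connected-copy⇒GPC {p} {H} e connector short with Fin-inhabited? (n H)
... | no ¬v = H , empty-GPCWitness p H ¬v , e
... | yes v = Sub , witness , Sub↪D
  where open ConnectedCopy e connector short v

module _ {D : Digraph} {X : Subset (n D)} {c : V D} where

  SimplePath-stays-in-SCC : ∀ {u v} → SameSCC D X c u → SameSCC D X c v →
    (π : SimplePath D (_∉ X) u v) → ∀ {w} → w ∈ u ∷ SP.tail π → SameSCC D X c w
  SimplePath-stays-in-SCC (c⇝u , _) (_ , v⇝c) π w∈ =
    Reach-trans c⇝u (Chain⇒Reach-from-start (SP.chain π) (SP.allowed π) w∈) ,
    Reach-trans (subst (Reach D _ _) (SP.ends-at π) (Chain⇒Reach-to-end (SP.chain π) (SP.allowed π) w∈))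
                v⇝c

  SCC-path-short : ∀ {p P u v} → IsDirectedPath p P → c ∉ X → ¬ SCCContains D X P →
    SameSCC D X c u → SameSCC D X c v → (π : SimplePath D (_∉ X) u v) → length (SP.tail π) < p
  SCC-path-short {p} {u = u} iso c∉X noP cu cv π with p ≤? length (SP.tail π)
  ... | no p≰ = ≰⇒> p≰
  ... | yes p≤ = ⊥-elim (noP (c , c∉X , embed-iso iso Pₚ↪D , λ x →
          SimplePath-stays-in-SCC cu cv π (vertexAt-∈ p u (SP.tail π) p≤ (Iso.from iso x))))
    where Pₚ↪D = path-embedding p u (SP.tail π) p≤ (SP.unique π) (SP.chain π)

PathFree⇒HFree : ∀ {𝓗 P p D X H} → IsDirectedPath p P → FreeOfHMinus 𝓗 p D →
  ¬ SCCContains D X P → H ∈ 𝓗 → ¬ SCCContains D X H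
PathFree⇒HFree {H = H} iso free noP H∈ (c , c∉X , e , inSCC) =
  let G , w , G↪D = connected-copy⇒GPC e connector
                      (λ a b → SCC-path-short iso c∉X noP (inSCC a) (inSCC b) (connector a b))
  in free G (H , H∈ , w) G↪D
  where
  connector : ∀ a b → SimplePath _ _ (Embedding.map e a) (Embedding.map e b)
  connector a b = Reach⇒SimplePath (Reach-trans (proj₂ (inSCC a)) (proj₁ (inSCC b)))

lemma26 : (𝓗 : List Digraph) (P : Digraph) (p : ℕ) →
    P ∈ 𝓗 → IsDirectedPath p P →
    (D : Digraph) → FreeOfHMinus 𝓗 p D → (k : ℤ) →
    YesInstance (InList 𝓗) D k ⇔ YesInstance (Singleton P) D k
lemma26 𝓗 P p P∈𝓗 iso D free k = record
  { to        = λ (X , X≤k , noH) → X , X≤k , λ { _ refl → noH P P∈𝓗 }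
  ; from      = λ (X , X≤k , noP) → X , X≤k , λ _ → PathFree⇒HFree iso free (noP P refl)
  ; to-cong   = λ { refl → refl }
  ; from-cong = λ { refl → refl }
  }
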